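{- Let $G$ be a graph with girth $g(G)\ge 7$. Then every part $C$ of every partition of $V(G)$ into exactly $\chi_{\mu_2}(G)$ $2$-distance mutual-visibility sets satisfies $C\subseteq N_G[v]$ for some vertex $v\in V(G)$. In particular, if $|C|\ge 3$, then $C\subseteq N_G(v)$ for some vertex $v\in V(G)$.
   Context: All graphs are finite, simple and undirected. The girth $g(G)$ is the length of a shortest cycle of $G$, with $g(G)=\infty$ if $G$ is a forest. $N_G(v)$ is the open neighborhood of $v$ and $N_G[v]=N_G(v)\cup\{v\}$. A $u,v$-geodesic is a shortest $u,v$-path. A set $M\subseteq V(G)$ is a $2$-distance mutual-visibility set if for every two distinct $u,v\in M$ there is a $u,v$-geodesic of length at most $2$ none of whose internal vertices lies in $M$. $\chi_{\mu_2}(G)$ is the minimum number of parts in a partition of $V(G)$ into $2$-distance mutual-visibility sets. -}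

module Defs where

open import Level using (0ℓ)
open import Data.Nat using (ℕ; zero; suc; _≤_; _<_)
open import Data.Fin using (Fin; toℕ; fromℕ; inject₁) renaming (zero to fz; suc to fs)
open import Data.Product using (Σ; ∃; ∃-syntax; _×_; _,_)
open import Data.Sum using (_⊎_)
open import Data.Empty using (⊥)
open import Relation.Nullary using (¬_)
open import Relation.Binary.PropositionalEquality using (_≡_; _≢_)
open import Function.Definitions using (Injective; Surjective)

record Graph (n : ℕ) : Set₁ where
  field
    Adj     : Fin n → Fin n → Set
    sym     : ∀ {x y} → Adj x y → Adj y x
    irrefl  : ∀ {x} → ¬ Adj x x

open Graph public

module _ {n : ℕ} (G : Graph n) where

  IsCycle : (k : ℕ) → (Fin k → Fin n) → Set
  IsCycle zero c = ⊥
  IsCycle (suc k) c =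
    Injective _≡_ _≡_ c
    × (∀ (i : Fin k) → Adj G (c (inject₁ i)) (c (fs i)))
    × Adj G (c (fromℕ k)) (c fz)

  -- girth g(G) ≥ 7 (including g(G) = ∞): no cycle of length 3,4,5 or 6.
  GirthAtLeast7 : Set
  GirthAtLeast7 = ∀ (k : ℕ) → 3 ≤ k → k < 7 → ∀ (c : Fin k → Fin n) → ¬ IsCycle k c

  IsWalk : (u v : Fin n) (k : ℕ) → (Fin (suc k) → Fin n) → Set
  IsWalk u v k p =
    p fz ≡ u × p (fromℕ k) ≡ v × (∀ (i : Fin k) → Adj G (p (inject₁ i)) (p (fs i)))

  IsPath : (u v : Fin n) (k : ℕ) → (Fin (suc k) → Fin n) → Set
  IsPath u v k p = IsWalk u v k p × Injective _≡_ _≡_ p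

  IsGeodesic : (u v : Fin n) (k : ℕ) → (Fin (suc k) → Fin n) → Set
  IsGeodesic u v k p =
    IsPath u v k p × (∀ (m : ℕ) → m < k → ∀ (q : Fin (suc m) → Fin n) → ¬ IsWalk u v m q)

  Internal : (k : ℕ) → Fin (suc k) → Set
  Internal k i = 0 < toℕ i × toℕ i < k

  Is2DMV : (Fin n → Set) → Set
  Is2DMV M =
    ∀ u v → M u → M v → u ≢ v →
      ∃[ k ] (k ≤ 2 × ∃[ p ] (IsGeodesic u v k p ×
                 (∀ i → Internal k i → ¬ M (p i))))

  -- A partition of V(G) into exactly k 2-distance mutual-visibility sets:
  -- part c is {x | col x ≡ c}; parts are nonempty (col surjective).
  Is2DMVPartition : (k : ℕ) → (Fin n → Fin k) → Set
  Is2DMVPartition k col =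
    Surjective _≡_ _≡_ col × (∀ (c : Fin k) → Is2DMV (λ x → col x ≡ c))

  IsChiMu2 : ℕ → Set
  IsChiMu2 k =
    (∃[ col ] Is2DMVPartition k col)
    × (∀ (m : ℕ) (col : Fin n → Fin m) → Is2DMVPartition m col → k ≤ m)

  InClosedNbhd : Fin n → Fin n → Set
  InClosedNbhd v x = x ≡ v ⊎ Adj G v x

  InOpenNbhd : Fin n → Fin n → Set
  InOpenNbhd v x = Adj G v x

-- Let M be a 2-distance mutual-visibility set and a, b ∈ M. If a and b are not
-- adjacent, they have a common neighbour w ∉ M. Every other x ∈ M is within
-- distance 2 of both a and b, and gluing these short a,x- and b,x-paths to
-- a - w - b closes a cycle of length 4, 5 or 6 unless x is adjacent to w; so
-- M ⊆ N(w). If no such b exists, M ⊆ N[a]. Finally, if a member v of M had two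
-- neighbours y, z in M, then y, z would have to be adjacent or share a
-- neighbour other than v, giving a 3- or 4-cycle; hence a part with three
-- vertices avoids its centre.
module Submission where

open import Defs
open import Data.Nat using (ℕ; zero; suc; _≤?_; _<?_; z≤n; s≤s)
open import Data.Fin using (Fin; inject₁; fromℕ; _≟_) renaming (zero to fz; suc to fs)
open import Data.Fin.Properties using (∀-cons)
open import Data.Vec using (Vec; []; _∷_; lookup)
open import Data.Vec.Relation.Unary.All using ([]; _∷_)
open import Data.Vec.Relation.Unary.AllPairs using ([]; _∷_)
open import Data.Vec.Relation.Unary.Unique.Propositional using (Unique)
open import Data.Vec.Relation.Unary.Unique.Propositional.Properties using (lookup-injective)
open import Data.Product using (_×_; ∃; ∃-syntax; _,_; proj₁; proj₂)
open import Data.Sum using (_⊎_; inj₁; inj₂)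
open import Data.Empty using (⊥; ⊥-elim)
open import Relation.Nullary using (¬_; yes; no)
open import Relation.Nullary.Decidable using (True; toWitness)
open import Relation.Unary using (Pred; Decidable)
open import Relation.Binary.PropositionalEquality
  using (_≡_; _≢_; refl; ≢-sym)

∃⊎∀ : ∀ {m ℓ} {P Q : Pred (Fin m) ℓ} → (∀ i → P i ⊎ Q i) → ∃ P ⊎ (∀ i → Q i)
∃⊎∀ {zero} f = inj₂ λ ()
∃⊎∀ {suc m} f with f fz | ∃⊎∀ (λ i → f (fs i))
... | inj₁ p | _            = inj₁ (fz , p)
... | inj₂ _ | inj₁ (i , p) = inj₁ (fs i , p)
... | inj₂ q | inj₂ qs      = inj₂ (∀-cons q qs)

module _ {n : ℕ} (G : Graph n) where

  adj⇒≢ : ∀ {x y} → Adj G x y → x ≢ y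
  adj⇒≢ xy refl = irrefl G xy

  data Visible (M : Fin n → Set) (u v : Fin n) : Set where
    adjacent : Adj G u v → Visible M u v
    through  : ∀ w → Adj G u w → Adj G w v → ¬ M w → Visible M u v

  visible : ∀ {M u v} → Is2DMV G M → M u → M v → u ≢ v → Visible M u v
  visible vis mu mv u≢v with vis _ _ mu mv u≢v
  ... | 0 , _ , _ , (((refl , p0≡v , _) , _) , _) , _ = ⊥-elim (u≢v p0≡v)
  ... | 1 , _ , _ , (((refl , refl , step) , _) , _) , _ = adjacent (step fz)
  ... | 2 , _ , p , (((refl , refl , step) , _) , _) , hidden =
    through (p (fs fz)) (step fz) (step (fs fz)) (hidden (fs fz) (s≤s z≤n , s≤s (s≤s z≤n)))
  ... | suc (suc (suc _)) , s≤s (s≤s ()) , _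

module Girth7 {n : ℕ} (G : Graph n) (girth : GirthAtLeast7 G) where

  noShortCycle : ∀ {k} {3≤k : True (3 ≤? suc k)} {k<7 : True (suc k <? 7)}
    (vs : Vec (Fin n) (suc k)) → Unique vs →
    (∀ i → Adj G (lookup vs (inject₁ i)) (lookup vs (fs i))) →
    ¬ Adj G (lookup vs (fromℕ k)) (lookup vs fz)
  noShortCycle {k} {3≤k} {k<7} vs unique steps closing =
    girth (suc k) (toWitness 3≤k) (toWitness k<7) (lookup vs)
      ((λ {i} {j} → lookup-injective unique i j) , steps , closing)

  noTriangle : ∀ {a b c} → Adj G a b → Adj G b c → ¬ Adj G c a
  noTriangle ab bc ca = noShortCycle (_ ∷ _ ∷ _ ∷ [])
    ((adj⇒≢ G ab ∷ ≢-sym (adj⇒≢ G ca) ∷ []) ∷ (adj⇒≢ G bc ∷ []) ∷ [] ∷ [])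
    (λ { fz → ab ; (fs fz) → bc })
    ca

  noC4 : ∀ {a b c d} → Adj G a b → Adj G b c → Adj G c d → Adj G d a →
    a ≢ c → b ≢ d → ⊥
  noC4 ab bc cd da a≢c b≢d = noShortCycle (_ ∷ _ ∷ _ ∷ _ ∷ [])
    ((adj⇒≢ G ab ∷ a≢c ∷ ≢-sym (adj⇒≢ G da) ∷ []) ∷ (adj⇒≢ G bc ∷ b≢d ∷ [])
      ∷ (adj⇒≢ G cd ∷ []) ∷ [] ∷ [])
    (λ { fz → ab ; (fs fz) → bc ; (fs (fs fz)) → cd })
    da

  noC5 : ∀ {a b c d e} → Adj G a b → Adj G b c → Adj G c d → Adj G d e → Adj G e a →
    a ≢ c → a ≢ d → b ≢ d → b ≢ e → c ≢ e → ⊥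
  noC5 ab bc cd de ea a≢c a≢d b≢d b≢e c≢e = noShortCycle (_ ∷ _ ∷ _ ∷ _ ∷ _ ∷ [])
    ((adj⇒≢ G ab ∷ a≢c ∷ a≢d ∷ ≢-sym (adj⇒≢ G ea) ∷ []) ∷ (adj⇒≢ G bc ∷ b≢d ∷ b≢e ∷ [])
      ∷ (adj⇒≢ G cd ∷ c≢e ∷ []) ∷ (adj⇒≢ G de ∷ []) ∷ [] ∷ [])
    (λ { fz → ab ; (fs fz) → bc ; (fs (fs fz)) → cd ; (fs (fs (fs fz))) → de })
    ea

  noC6 : ∀ {a b c d e f} →
    Adj G a b → Adj G b c → Adj G c d → Adj G d e → Adj G e f → Adj G f a →
    a ≢ c → a ≢ d → a ≢ e → b ≢ d → b ≢ e → b ≢ f → c ≢ e → c ≢ f → d ≢ f → ⊥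
  noC6 ab bc cd de ef fa a≢c a≢d a≢e b≢d b≢e b≢f c≢e c≢f d≢f =
    noShortCycle (_ ∷ _ ∷ _ ∷ _ ∷ _ ∷ _ ∷ [])
      ((adj⇒≢ G ab ∷ a≢c ∷ a≢d ∷ a≢e ∷ ≢-sym (adj⇒≢ G fa) ∷ [])
        ∷ (adj⇒≢ G bc ∷ b≢d ∷ b≢e ∷ b≢f ∷ []) ∷ (adj⇒≢ G cd ∷ c≢e ∷ c≢f ∷ [])
        ∷ (adj⇒≢ G de ∷ d≢f ∷ []) ∷ (adj⇒≢ G ef ∷ []) ∷ [] ∷ [])
      (λ { fz → ab ; (fs fz) → bc ; (fs (fs fz)) → cd ; (fs (fs (fs fz))) → de
         ; (fs (fs (fs (fs fz)))) → ef })
      fa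

  adjacent-through⇒adj : ∀ {a w b q x} →
    Adj G a w → Adj G w b → Adj G a x → Adj G b q → Adj G q x →
    a ≢ b → b ≢ x → w ≢ x → Adj G w x
  adjacent-through⇒adj {w = w} {q = q} aw wb ax bq qx a≢b b≢x w≢x with q ≟ w
  ... | yes refl = qx
  ... | no q≢w   = ⊥-elim (noC5 aw wb bq qx (sym G ax)
                     a≢b (λ { refl → noTriangle aw wb bq }) (≢-sym q≢w) w≢x b≢x)

  through-through⇒adj : ∀ {a w b p q x} →
    Adj G a w → Adj G w b → Adj G a p → Adj G p x → Adj G b q → Adj G q x →
    a ≢ b → a ≢ x → b ≢ x → w ≢ x → Adj G w x
  through-through⇒adj {w = w} {p = p} {q = q} aw wb ap px bq qx a≢b a≢x b≢x w≢x
    with p ≟ w | q ≟ w | p ≟ q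
  ... | yes refl | _        | _        = px
  ... | no _     | yes refl | _        = qx
  ... | no p≢w   | no _     | yes refl = ⊥-elim (noC4 aw wb bq (sym G ap) a≢b (≢-sym p≢w))
  ... | no p≢w   | no q≢w   | no p≢q   = ⊥-elim (noC6 aw wb bq qx (sym G px) (sym G ap)
        a≢b (λ { refl → noTriangle aw wb bq }) a≢x (≢-sym q≢w) w≢x (≢-sym p≢w)
        b≢x (λ { refl → noTriangle (sym G wb) (sym G aw) ap }) (≢-sym p≢q))

  module _ {M : Fin n → Set} (vis : Is2DMV G M) where

    ∉⇒≢ : ∀ {w x} → ¬ M w → M x → w ≢ x
    ∉⇒≢ ¬mw mx refl = ¬mw mx

    hiddenMiddle-dominates : ∀ {a w b} → M a → M b → a ≢ b →
      Adj G a w → Adj G w b → ¬ M w → ∀ {x} → M x → Adj G w x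
    hiddenMiddle-dominates {a} {w} {b} ma mb a≢b aw wb ¬mw {x} mx with x ≟ a | x ≟ b
    ... | yes refl | _        = sym G aw
    ... | no _     | yes refl = wb
    ... | no x≢a   | no x≢b
      with visible G vis ma mx (≢-sym x≢a) | visible G vis mb mx (≢-sym x≢b)
    ... | adjacent ax       | adjacent bx       =
      ⊥-elim (noC4 aw wb bx (sym G ax) a≢b (∉⇒≢ ¬mw mx))
    ... | adjacent ax       | through _ bq qx _ =
      adjacent-through⇒adj aw wb ax bq qx a≢b (≢-sym x≢b) (∉⇒≢ ¬mw mx)
    ... | through _ ap px _ | adjacent bx       =
      adjacent-through⇒adj (sym G wb) (sym G aw) bx ap px (≢-sym a≢b) (≢-sym x≢a) (∉⇒≢ ¬mw mx)
    ... | through _ ap px _ | through _ bq qx _ =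
      through-through⇒adj aw wb ap px bq qx a≢b (≢-sym x≢a) (≢-sym x≢b) (∉⇒≢ ¬mw mx)

    -- Adjacency is not decidable here; the case split on it is supplied by `visible`.
    hiddenPath-or-closedNbhd : Decidable M → ∀ {a} → M a → ∀ x →
      (M x × x ≢ a × ∃[ w ] (Adj G a w × Adj G w x × ¬ M w)) ⊎ (M x → InClosedNbhd G a x)
    hiddenPath-or-closedNbhd M? ma x with M? x | x ≟ _
    ... | no ¬mx | _        = inj₂ λ mx → ⊥-elim (¬mx mx)
    ... | yes _  | yes x≡a  = inj₂ λ _ → inj₁ x≡a
    ... | yes mx | no x≢a with visible G vis ma mx (≢-sym x≢a)
    ...   | adjacent ax          = inj₂ λ _ → inj₂ ax
    ...   | through w aw wx ¬mw  = inj₁ (mx , x≢a , w , aw , wx , ¬mw)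

    ⊆closedNbhd : Decidable M → ∀ {a} → M a → ∃[ v ] (∀ x → M x → InClosedNbhd G v x)
    ⊆closedNbhd M? {a} ma with ∃⊎∀ (hiddenPath-or-closedNbhd M? ma)
    ... | inj₁ (b , mb , b≢a , w , aw , wb , ¬mw) =
      w , λ x mx → inj₂ (hiddenMiddle-dominates ma mb (≢-sym b≢a) aw wb ¬mw mx)
    ... | inj₂ ⊆N[a] = a , ⊆N[a]

    ¬twoNeighboursInSet : ∀ {v y z} → M v → M y → M z → y ≢ z → Adj G v y → ¬ Adj G v z
    ¬twoNeighboursInSet {v} mv my mz y≢z vy vz with visible G vis my mz y≢z
    ... | adjacent yz = noTriangle vy yz (sym G vz)
    ... | through w yw wz ¬mw with w ≟ v
    ...   | yes refl = ¬mw mv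
    ...   | no w≢v   = noC4 vy yw wz (sym G vz) (≢-sym w≢v) y≢z

    module _ {v : Fin n} (⊆N[v] : ∀ x → M x → InClosedNbhd G v x) where

      adjacent-if-≢ : ∀ {y} → M y → y ≢ v → Adj G v y
      adjacent-if-≢ {y} my y≢v with ⊆N[v] y my
      ... | inj₁ y≡v = ⊥-elim (y≢v y≡v)
      ... | inj₂ vy  = vy

      centre∉ : ∀ {a b d} → M a → M b → M d → a ≢ b → a ≢ d → b ≢ d → ¬ M v
      centre∉ {a} {b} ma mb md a≢b a≢d b≢d mv with a ≟ v | b ≟ v
      ... | yes refl | _        = ¬twoNeighboursInSet mv mb md b≢d
                                    (adjacent-if-≢ mb (≢-sym a≢b)) (adjacent-if-≢ md (≢-sym a≢d))
      ... | no a≢v   | yes refl = ¬twoNeighboursInSet mv ma md a≢d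
                                    (adjacent-if-≢ ma a≢v) (adjacent-if-≢ md (≢-sym b≢d))
      ... | no a≢v   | no b≢v   = ¬twoNeighboursInSet mv ma mb a≢b
                                    (adjacent-if-≢ ma a≢v) (adjacent-if-≢ mb b≢v)

      ⊆openNbhd : ∀ {a b d} → M a → M b → M d → a ≢ b → a ≢ d → b ≢ d →
        ∀ x → M x → InOpenNbhd G v x
      ⊆openNbhd ma mb md a≢b a≢d b≢d x mx =
        adjacent-if-≢ mx λ { refl → centre∉ ma mb md a≢b a≢d b≢d mx }

lemma3p3 : ∀ (n : ℕ) (G : Graph n) → GirthAtLeast7 G →
    ∀ (k : ℕ) → IsChiMu2 G k →
    ∀ (col : Fin n → Fin k) → Is2DMVPartition G k col →
    ∀ (c : Fin k) →
      (∃[ v ] (∀ x → col x ≡ c → InClosedNbhd G v x))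
      × (∀ (a b d : Fin n) → col a ≡ c → col b ≡ c → col d ≡ c →
           a ≢ b → a ≢ d → b ≢ d →
           ∃[ v ] (∀ x → col x ≡ c → InOpenNbhd G v x))
lemma3p3 n G girth k _ col (surjective , visibility) c =
  centre , λ _ _ _ ma mb md a≢b a≢d b≢d →
    proj₁ centre , ⊆openNbhd (visibility c) (proj₂ centre) ma mb md a≢b a≢d b≢d
  where
  open Girth7 G girth
  centre : ∃[ v ] (∀ x → col x ≡ c → InClosedNbhd G v x)
  centre = ⊆closedNbhd (visibility c) (λ x → col x ≟ c) (proj₂ (surjective c) refl)
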